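{- Let $\mathcal C=(l_1,l_2,\ldots,l_n)$ and $\mathcal C'=(l_n,l_{n-1},\ldots,l_1)$ be a pair of anti-caterpillars on the same leaf set with $n\ge 2$ leaves. Then $\mathrm{mast}(\mathcal C,\mathcal C')=2$.
   Context: All trees are rooted binary phylogenetic trees: rooted trees with leaves labelled bijectively by a finite set, root of degree two and other interior vertices of degree three (or a single vertex if there is one leaf). An $n$-caterpillar $(l_1,l_2,\ldots,l_n)$ is such a tree with leaf set $\{l_1,\ldots,l_n\}$ in which, if $n\ge2$, $l_1$ and $l_2$ have the same parent and, for every $i\in\{2,\ldots,n-1\}$, $(p_{i+1},p_i)$ is an edge, where $p_j$ denotes the parent of $l_j$. Two caterpillars $(l_1,\ldots,l_n)$ and $(l'_1,\ldots,l'_n)$ on the same leaf set with $l_i=l'_{n-i+1}$ for all $i$ are a pair of anti-caterpillars. For trees $\mathcal S,\mathcal T$, $\mathrm{mast}(\mathcal S,\mathcal T)$ is the maximum $|Y|$ over subsets $Y$ of the common leaf set such that the restrictions $\mathcal S|Y$ and $\mathcal T|Y$ (minimal subtree spanning $Y$, with non-root degree-two vertices suppressed) are isomorphic as leaf-labelled rooted trees. -}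

module Defs where

open import Data.Nat using (ℕ; _≤_; suc)
open import Data.List using (List; []; _∷_; length; reverse)
open import Data.List.Relation.Unary.Unique.Propositional using (Unique)
open import Data.List.Relation.Unary.All using (All)
open import Data.List.NonEmpty as List⁺ using (List⁺; _∷_)
open import Data.Maybe using (Maybe; just; nothing)
open import Data.Product using (Σ; _×_; _,_)
open import Data.Sum using (_⊎_)
open import Relation.Binary.Definitions using (DecidableEquality)
open import Relation.Binary.PropositionalEquality using (_≡_)
open import Relation.Nullary using (yes; no)
import Data.List.Membership.DecPropositional as DecMem
open import Data.List.Membership.Propositional using (_∈_)

-- Rooted binary trees with leaves labelled by elements of A.
-- Children are unordered: this is captured by the isomorphism relation _≅_ below.
data Tree (A : Set) : Set where
  leaf : A → Tree A
  node : Tree A → Tree A → Tree A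

leaves : {A : Set} → Tree A → List A
leaves (leaf a) = a ∷ []
leaves (node l r) = leaves l Data.List.++ leaves r

IsPhylogenetic : {A : Set} → Tree A → Set
IsPhylogenetic t = Unique (leaves t)

data _≅_ {A : Set} : Tree A → Tree A → Set where
  leaf≅ : (a : A) → leaf a ≅ leaf a
  node≅ : {l r l' r' : Tree A} →
          ((l ≅ l') × (r ≅ r')) ⊎ ((l ≅ r') × (r ≅ l')) →
          node l r ≅ node l' r'

data _≅?_ {A : Set} : Maybe (Tree A) → Maybe (Tree A) → Set where
  nothing≅ : nothing ≅? nothing
  just≅ : {s t : Tree A} → s ≅ t → just s ≅? just t

module _ {A : Set} (_≟_ : DecidableEquality A) where
  open DecMem _≟_ using (_∈?_)

  -- Restriction T|Y: minimal subtree spanning Y with degree-two vertices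
  -- suppressed (nothing = empty tree, when no leaf of T lies in Y).
  restrict : Tree A → List A → Maybe (Tree A)
  restrict (leaf a) Y with a ∈? Y
  ... | yes _ = just (leaf a)
  ... | no _ = nothing
  restrict (node l r) Y with restrict l Y | restrict r Y
  ... | just l' | just r' = just (node l' r')
  ... | just l' | nothing = just l'
  ... | nothing | just r' = just r'
  ... | nothing | nothing = nothing

  Agreement : Tree A → Tree A → List A → Set
  Agreement S T Y =
    Unique Y × All (_∈ leaves S) Y × All (_∈ leaves T) Y ×
    (restrict S Y ≅? restrict T Y)

  MastIs : Tree A → Tree A → ℕ → Set
  MastIs S T k =
    Σ (List A) (λ Y → Agreement S T Y × length Y ≡ k) ×
    ((Y : List A) → Agreement S T Y → length Y ≤ k)

-- Caterpillar-building helper: (l₁ , … , lₙ) written in reverse order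
-- lₙ ∷ … ∷ l₁; the tree is node (caterpillar of l₁..lₙ₋₁) (leaf lₙ).
catRev : {A : Set} → A → List A → Tree A
catRev a [] = leaf a
catRev a (b ∷ bs) = node (catRev b bs) (leaf a)

-- The n-caterpillar (l₁ , l₂ , … , lₙ) for a nonempty list l₁ ∷ … ∷ lₙ:
-- l₁, l₂ are siblings and the parent of lᵢ₊₁ is the parent of the parent of lᵢ
-- (for n = 1 it is the single vertex l₁).
caterpillar : {A : Set} → List⁺ A → Tree A
caterpillar L with List⁺.reverse L
... | x ∷ xs = catRev x xs

-- The restriction of the caterpillar (l₁,…,lₙ) to Y is the caterpillar of the
-- subsequence of l₁,…,lₙ lying in Y, so the restrictions of two anti-caterpillars
-- are again anti-caterpillars. Anti-caterpillars on at most two leaves coincide,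
-- while on three or more distinct leaves they differ at the root: its leaf child is
-- the last leaf in one and the first leaf in the other. Hence the agreement sets are
-- exactly the sets of at most two leaves.
module Submission where

open import Defs
open import Data.Nat using (ℕ; _≤_)
open import Data.List.NonEmpty using (List⁺; toList; length; reverse)
open import Data.List.Relation.Unary.Unique.Propositional using (Unique)
open import Relation.Binary.Definitions using (DecidableEquality)

open import Data.Bool using (true; false)
open import Data.Empty using (⊥-elim)
open import Data.Fin using (zero; suc)
open import Data.Fin.Properties using (pigeonhole; <-irrefl)
import Data.List as List
open import Data.List using (List; []; _∷_; _++_; _∷ʳ_; filter; lookup)
open import Data.List.Properties using (unfold-reverse; filter-++; ++-identityʳ; reverse-involutive)
open import Data.List.Relation.Binary.Subset.Propositional using (_⊆_)
open import Data.List.Relation.Unary.All as All using (All; []; _∷_)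
open import Data.List.Relation.Unary.AllPairs using ([]; _∷_)
open import Data.List.Relation.Unary.Any using (here; there; index)
open import Data.List.Relation.Unary.Any.Properties using (lookup-index; reverse⁺)
import Data.List.Relation.Unary.Unique.Propositional.Properties as Unique
open import Data.List.Membership.Propositional using (_∈_)
open import Data.List.Membership.Propositional.Properties
  using (∈-lookup; ∈-filter⁺; ∈-filter⁻)
import Data.List.Membership.DecPropositional as DecMembership
import Data.List.NonEmpty as List⁺
open import Data.Maybe using (Maybe; just; nothing)
open import Data.Nat using (suc; z≤n; s≤s)
open import Data.Nat.Properties using (≤-trans; ≤-pred; ≰⇒>; _≤?_)
open import Data.Product using (∃-syntax; _×_; _,_; proj₂)
open import Data.Sum using (inj₁; inj₂)
import Data.Vec as Vec
import Data.Vec.Properties as Vec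
open import Relation.Nullary using (¬_; yes; no; does)
open import Relation.Unary using (Pred; Decidable)
open import Relation.Binary.PropositionalEquality
  using (_≡_; refl; sym; trans; cong; subst; subst₂; module ≡-Reasoning)

open ≡-Reasoning

module _ {A : Set} where

  lookup-injective : {xs : List A} → Unique xs →
                     ∀ i j → lookup xs i ≡ lookup xs j → i ≡ j
  lookup-injective (_  ∷ _) zero    zero    _  = refl
  lookup-injective (x∉ ∷ _) zero    (suc j) eq = ⊥-elim (All.lookup x∉ (∈-lookup j) eq)
  lookup-injective (x∉ ∷ _) (suc i) zero    eq = ⊥-elim (All.lookup x∉ (∈-lookup i) (sym eq))
  lookup-injective (_  ∷ u) (suc i) (suc j) eq = cong suc (lookup-injective u i j eq)

  -- If xs were longer, two entries of xs would sit at the same position of ys.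
  Unique-⊆⇒length≤ : {xs ys : List A} → Unique xs → xs ⊆ ys →
                     List.length xs ≤ List.length ys
  Unique-⊆⇒length≤ {xs} {ys} u xs⊆ys with List.length xs ≤? List.length ys
  ... | yes xs≤ys = xs≤ys
  ... | no xs≰ys with pigeonhole (≰⇒> xs≰ys) (λ i → index (xs⊆ys (∈-lookup i)))
  ...   | i , j , i<j , same-position = ⊥-elim (<-irrefl i≡j i<j)
    where
    at : ∀ k → lookup xs k ≡ lookup ys (index (xs⊆ys (∈-lookup k)))
    at k = lookup-index (xs⊆ys (∈-lookup k))

    i≡j : i ≡ j
    i≡j = lookup-injective u i j
            (trans (at i) (trans (cong (lookup ys) same-position) (sym (at j))))

  filter-reverse : ∀ {p} {P : Pred A p} (P? : Decidable P) (xs : List A) →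
                   filter P? (List.reverse xs) ≡ List.reverse (filter P? xs)
  filter-reverse P? [] = refl
  filter-reverse P? (x ∷ xs) = begin
    filter P? (List.reverse (x ∷ xs))          ≡⟨ cong (filter P?) (unfold-reverse x xs) ⟩
    filter P? (List.reverse xs ∷ʳ x)           ≡⟨ filter-++ P? (List.reverse xs) List.[ x ] ⟩
    filter P? (List.reverse xs) ++ filter P? List.[ x ]
                                               ≡⟨ cong (_++ filter P? List.[ x ]) (filter-reverse P? xs) ⟩
    List.reverse (filter P? xs) ++ filter P? List.[ x ]
                                               ≡⟨ snoc-filtered ⟩
    List.reverse (filter P? (x ∷ xs))          ∎
    where
    snoc-filtered : List.reverse (filter P? xs) ++ filter P? List.[ x ] ≡
                    List.reverse (filter P? (x ∷ xs))
    snoc-filtered with does (P? x)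
    ... | true  = sym (unfold-reverse x (filter P? xs))
    ... | false = ++-identityʳ _

  reverse-∷-∷ : (a b : A) (xs : List A) →
                ∃[ x ] ∃[ y ] ∃[ ys ] List.reverse (a ∷ b ∷ xs) ≡ x ∷ y ∷ ys × x ∈ b ∷ xs
  reverse-∷-∷ a b [] = b , a , [] , refl , here refl
  reverse-∷-∷ a b (c ∷ cs) with reverse-∷-∷ b c cs
  ... | x , y , ys , eq , x∈ = x , y , ys ∷ʳ a , reversed , there x∈
    where
    reversed : List.reverse (a ∷ b ∷ c ∷ cs) ≡ x ∷ y ∷ ys ∷ʳ a
    reversed = trans (unfold-reverse a (b ∷ c ∷ cs)) (cong (_∷ʳ a) eq)

  toList-reverse : (L : List⁺ A) → toList (reverse L) ≡ List.reverse (toList L)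
  toList-reverse L@(x List⁺.∷ xs) = begin
    toList (reverse L)                                     ≡⟨ toList∘fromVec (Vec.reverse (List⁺.toVec L)) ⟩
    Vec.toList (Vec.reverse (List⁺.toVec L))               ≡⟨ Vec.toList-reverse (List⁺.toVec L) ⟩
    List.reverse (x ∷ Vec.toList (Vec.fromList xs))        ≡⟨ cong (λ ys → List.reverse (x ∷ ys)) (Vec.toList∘fromList xs) ⟩
    List.reverse (toList L)                                ∎
    where
    toList∘fromVec : ∀ {n} (v : Vec.Vec A (suc n)) → toList (List⁺.fromVec v) ≡ Vec.toList v
    toList∘fromVec (_ Vec.∷ _) = refl

  -- Mirrors the node clause of restrict.
  node? : Maybe (Tree A) → Maybe (Tree A) → Maybe (Tree A)
  node? (just l) (just r) = just (node l r)
  node? (just l) nothing  = just l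
  node? nothing  r        = r

  catRev? : List A → Maybe (Tree A)
  catRev? []       = nothing
  catRev? (a ∷ as) = just (catRev a as)

  catRev?-∷ : (a : A) (as : List A) → catRev? (a ∷ as) ≡ node? (catRev? as) (just (leaf a))
  catRev?-∷ a []       = refl
  catRev?-∷ a (_ ∷ _)  = refl

  leaves-catRev : (a : A) (as : List A) → leaves (catRev a as) ≡ List.reverse (a ∷ as)
  leaves-catRev a []       = refl
  leaves-catRev a (b ∷ bs) = begin
    leaves (catRev b bs) ++ List.[ a ]   ≡⟨ cong (_++ List.[ a ]) (leaves-catRev b bs) ⟩
    List.reverse (b ∷ bs) ∷ʳ a           ≡⟨ unfold-reverse a (b ∷ bs) ⟨
    List.reverse (a ∷ b ∷ bs)            ∎

  caterpillar-catRev : (L : List⁺ A) →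
    caterpillar L ≡ catRev (List⁺.head (reverse L)) (List⁺.tail (reverse L))
  caterpillar-catRev L with reverse L
  ... | _ List⁺.∷ _ = refl

  leaves-caterpillar : (L : List⁺ A) → leaves (caterpillar L) ≡ toList L
  leaves-caterpillar L = begin
    leaves (caterpillar L)               ≡⟨ cong leaves (caterpillar-catRev L) ⟩
    leaves (catRev (List⁺.head (reverse L)) (List⁺.tail (reverse L)))
                                         ≡⟨ leaves-catRev (List⁺.head (reverse L)) (List⁺.tail (reverse L)) ⟩
    List.reverse (toList (reverse L))    ≡⟨ cong List.reverse (toList-reverse L) ⟩
    List.reverse (List.reverse (toList L)) ≡⟨ reverse-involutive (toList L) ⟩
    toList L                             ∎

  -- In a caterpillar with at least three leaves only one child of the root is a leaf,
  -- so isomorphism preserves that leaf.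
  ≅-root-leaf : {t P Q : Tree A} {x a : A} →
                node t (leaf x) ≅ node (node P Q) (leaf a) → x ≡ a
  ≅-root-leaf (node≅ (inj₁ (_ , leaf≅ _))) = refl
  ≅-root-leaf (node≅ (inj₂ (_ , ())))

  catRev?-reverse-≇ : {F : List A} → Unique F → 3 ≤ List.length F →
                      ¬ (catRev? (List.reverse F) ≅? catRev? F)
  catRev?-reverse-≇ {a ∷ b ∷ c ∷ r} (a∉ ∷ _) _ iso
    with reverse-∷-∷ a b (c ∷ r)
  ... | x , y , ys , eq , x∈ rewrite eq with iso
  ...   | just≅ t≅ = All.lookup a∉ x∈ (sym (≅-root-leaf t≅))
  catRev?-reverse-≇ {_ ∷ []}     _ (s≤s ())
  catRev?-reverse-≇ {_ ∷ _ ∷ []} _ (s≤s (s≤s ()))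

  length≤2⇒catRev?-reverse-≅ : (F : List A) → List.length F ≤ 2 →
                               catRev? (List.reverse F) ≅? catRev? F
  length≤2⇒catRev?-reverse-≅ []          _ = nothing≅
  length≤2⇒catRev?-reverse-≅ (a ∷ [])     _ = just≅ (leaf≅ a)
  length≤2⇒catRev?-reverse-≅ (a ∷ b ∷ []) _ = just≅ (node≅ (inj₂ (leaf≅ a , leaf≅ b)))
  length≤2⇒catRev?-reverse-≅ (_ ∷ _ ∷ _ ∷ _) (s≤s (s≤s ()))

  catRev?-reverse-≅⇒length≤2 : {F : List A} → Unique F →
                               catRev? (List.reverse F) ≅? catRev? F → List.length F ≤ 2
  catRev?-reverse-≅⇒length≤2 {F} u iso with 3 ≤? List.length F
  ... | yes 3≤ = ⊥-elim (catRev?-reverse-≇ u 3≤ iso)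
  ... | no 3≰  = ≤-pred (≰⇒> 3≰)

module _ {A : Set} (_≟_ : DecidableEquality A) where
  open DecMembership _≟_ using (_∈?_)

  restrict-node : (l r : Tree A) (Y : List A) →
                  restrict _≟_ (node l r) Y ≡ node? (restrict _≟_ l Y) (restrict _≟_ r Y)
  restrict-node l r Y with restrict _≟_ l Y | restrict _≟_ r Y
  ... | just _  | just _  = refl
  ... | just _  | nothing = refl
  ... | nothing | just _  = refl
  ... | nothing | nothing = refl

  restrict-catRev : (a : A) (as Y : List A) →
                    restrict _≟_ (catRev a as) Y ≡ catRev? (filter (_∈? Y) (a ∷ as))
  restrict-catRev a [] Y with a ∈? Y
  ... | yes _ = refl
  ... | no _  = refl
  restrict-catRev a (b ∷ bs) Y
    rewrite restrict-node (catRev b bs) (leaf a) Y | restrict-catRev b bs Y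
    with a ∈? Y
  ... | yes _ = sym (catRev?-∷ a (filter (_∈? Y) (b ∷ bs)))
  ... | no _  with catRev? (filter (_∈? Y) (b ∷ bs))
  ...   | just _  = refl
  ...   | nothing = refl

  restrict-caterpillar : (L : List⁺ A) (Y : List A) →
    restrict _≟_ (caterpillar L) Y ≡ catRev? (List.reverse (filter (_∈? Y) (toList L)))
  restrict-caterpillar L Y = begin
    restrict _≟_ (caterpillar L) Y
      ≡⟨ cong (λ t → restrict _≟_ t Y) (caterpillar-catRev L) ⟩
    restrict _≟_ (catRev (List⁺.head (reverse L)) (List⁺.tail (reverse L))) Y
      ≡⟨ restrict-catRev (List⁺.head (reverse L)) (List⁺.tail (reverse L)) Y ⟩
    catRev? (filter (_∈? Y) (toList (reverse L)))
      ≡⟨ cong (λ xs → catRev? (filter (_∈? Y) xs)) (toList-reverse L) ⟩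
    catRev? (filter (_∈? Y) (List.reverse (toList L)))
      ≡⟨ cong catRev? (filter-reverse (_∈? Y) (toList L)) ⟩
    catRev? (List.reverse (filter (_∈? Y) (toList L)))  ∎

  restrict-caterpillar-reverse : (L : List⁺ A) (Y : List A) →
    restrict _≟_ (caterpillar (reverse L)) Y ≡ catRev? (filter (_∈? Y) (toList L))
  restrict-caterpillar-reverse L Y = begin
    restrict _≟_ (caterpillar (reverse L)) Y
      ≡⟨ restrict-caterpillar (reverse L) Y ⟩
    catRev? (List.reverse (filter (_∈? Y) (toList (reverse L))))
      ≡⟨ cong (λ xs → catRev? (List.reverse (filter (_∈? Y) xs))) (toList-reverse L) ⟩
    catRev? (List.reverse (filter (_∈? Y) (List.reverse (toList L))))
      ≡⟨ cong (λ xs → catRev? (List.reverse xs)) (filter-reverse (_∈? Y) (toList L)) ⟩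
    catRev? (List.reverse (List.reverse (filter (_∈? Y) (toList L))))
      ≡⟨ cong catRev? (reverse-involutive (filter (_∈? Y) (toList L))) ⟩
    catRev? (filter (_∈? Y) (toList L))  ∎

  ∈-leaves-caterpillar-reverse : (L : List⁺ A) {x : A} →
    x ∈ toList L → x ∈ leaves (caterpillar (reverse L))
  ∈-leaves-caterpillar-reverse L x∈ =
    subst (_ ∈_) (sym (trans (leaves-caterpillar (reverse L)) (toList-reverse L))) (reverse⁺ x∈)

  module _ (L : List⁺ A) (L-unique : Unique (toList L)) where

    agreement⇒length≤2 : (Y : List A) →
      Agreement _≟_ (caterpillar L) (caterpillar (reverse L)) Y → List.length Y ≤ 2
    agreement⇒length≤2 Y (Y-unique , in-S , _ , iso) =
      ≤-trans (Unique-⊆⇒length≤ Y-unique Y⊆F)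
              (catRev?-reverse-≅⇒length≤2 (Unique.filter⁺ (_∈? Y) L-unique) F-iso)
      where
      F : List A
      F = filter (_∈? Y) (toList L)

      Y⊆F : Y ⊆ F
      Y⊆F y∈Y = ∈-filter⁺ (_∈? Y) (subst (_ ∈_) (leaves-caterpillar L) (All.lookup in-S y∈Y)) y∈Y

      F-iso : catRev? (List.reverse F) ≅? catRev? F
      F-iso = subst₂ _≅?_ (restrict-caterpillar L Y) (restrict-caterpillar-reverse L Y) iso

    length≤2⇒agreement : (Y : List A) → Unique Y → Y ⊆ toList L → List.length Y ≤ 2 →
      Agreement _≟_ (caterpillar L) (caterpillar (reverse L)) Y
    length≤2⇒agreement Y Y-unique Y⊆L Y≤2 =
      Y-unique ,
      All.tabulate (λ y∈Y → subst (_ ∈_) (sym (leaves-caterpillar L)) (Y⊆L y∈Y)) ,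
      All.tabulate (λ y∈Y → ∈-leaves-caterpillar-reverse L (Y⊆L y∈Y)) ,
      subst₂ _≅?_ (sym (restrict-caterpillar L Y)) (sym (restrict-caterpillar-reverse L Y))
        (length≤2⇒catRev?-reverse-≅ F (≤-trans (Unique-⊆⇒length≤ F-unique F⊆Y) Y≤2))
      where
      F : List A
      F = filter (_∈? Y) (toList L)

      F-unique : Unique F
      F-unique = Unique.filter⁺ (_∈? Y) L-unique

      F⊆Y : F ⊆ Y
      F⊆Y x∈F = proj₂ (∈-filter⁻ (_∈? Y) x∈F)

lemma4 : {A : Set} (_≟_ : DecidableEquality A) (L : List⁺ A) →
    Unique (toList L) → 2 ≤ length L →
    MastIs _≟_ (caterpillar L) (caterpillar (reverse L)) 2
lemma4 _≟_ L@(l₁ List⁺.∷ l₂ ∷ _) L-unique@(l₁∉ ∷ _) _ =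
  (l₁ ∷ l₂ ∷ [] , agreement , refl) , agreement⇒length≤2 _≟_ L L-unique
  where
  first-two⊆L : l₁ ∷ l₂ ∷ [] ⊆ toList L
  first-two⊆L (here refl)         = here refl
  first-two⊆L (there (here refl)) = there (here refl)

  agreement : Agreement _≟_ (caterpillar L) (caterpillar (reverse L)) (l₁ ∷ l₂ ∷ [])
  agreement = length≤2⇒agreement _≟_ L L-unique (l₁ ∷ l₂ ∷ [])
                ((All.head l₁∉ ∷ []) ∷ [] ∷ []) first-two⊆L (s≤s (s≤s z≤n))
lemma4 _ (_ List⁺.∷ []) _ (s≤s ())
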